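{- If $m\geq n\geq 2$ are integers, then $\gamma_{tR}(K_n\,\square\,K_m)=2n$.
   Context: $K_n\,\square\,K_m$ is the Cartesian product of complete graphs: vertices $v_{ij}$, $1\leq i\leq n$, $1\leq j\leq m$, with $v_{ij}$ adjacent to $v_{st}$ ($\neq v_{ij}$) iff $i=s$ or $j=t$. For a graph $G$ with no isolated vertices, a total Roman dominating function is a map $f:V(G)\to\{0,1,2\}$ such that every vertex with $f(v)=0$ is adjacent to a vertex $u$ with $f(u)=2$, and the subgraph induced by $\{v:f(v)>0\}$ has no isolated vertices; $\gamma_{tR}(G)$ is the minimum of $\sum_v f(v)$ over such $f$. -}

module Defs where

open import Data.Nat using (ℕ; zero; suc; _+_; _≤_)
open import Data.Fin using (Fin; toℕ) renaming (zero to fzero; suc to fsuc)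
open import Data.Product using (_×_; _,_; Σ; ∃; proj₁; proj₂)
open import Data.Sum using (_⊎_)
open import Data.Empty using (⊥)
open import Relation.Nullary using (¬_)
open import Relation.Binary.PropositionalEquality using (_≡_)

∑ : (k : ℕ) → (Fin k → ℕ) → ℕ
∑ zero    g = 0
∑ (suc k) g = g fzero + ∑ k (λ i → g (fsuc i))

-- Cartesian product K_n □ K_m : vertex set Fin n × Fin m,
-- (i , j) adjacent to (s , t) iff they are distinct and (i = s or j = t).
Vertex : ℕ → ℕ → Set
Vertex n m = Fin n × Fin m

Adj : {n m : ℕ} → Vertex n m → Vertex n m → Set
Adj {n} {m} (i , j) (s , t) = ¬ ((i , j) ≡ (s , t)) × ((i ≡ s) ⊎ (j ≡ t))

-- A labelling f : V → {0,1,2}; labels are elements of Fin 3, value toℕ.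
Labelling : ℕ → ℕ → Set
Labelling n m = Vertex n m → Fin 3

record IsTRDF {n m : ℕ} (f : Labelling n m) : Set where
  field
    dominating : ∀ v → toℕ (f v) ≡ 0 → Σ (Vertex n m) λ u → Adj v u × toℕ (f u) ≡ 2
    total : ∀ v → ¬ (toℕ (f v) ≡ 0) →
            Σ (Vertex n m) λ u → Adj v u × ¬ (toℕ (f u) ≡ 0)

weight : {n m : ℕ} → Labelling n m → ℕ
weight {n} {m} f = ∑ n (λ i → ∑ m (λ j → toℕ (f (i , j))))

γtR≡ : ℕ → ℕ → ℕ → Set
γtR≡ n m k =
  (Σ (Labelling n m) λ f → IsTRDF f × weight f ≡ k)
  × (∀ (f : Labelling n m) → IsTRDF f → k ≤ weight f)

module Submission where

-- Labelling one column with 2 and everything else with 0 is a TRDF of weight 2n.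
-- Conversely, call a line heavy if its weight is at least 2; since n ≤ m it
-- suffices that all rows or all columns are heavy. A line containing a 2 is heavy,
-- and a vertex whose row and column contain no 2 cannot be dominated, so it is
-- positive. Given a 2-free row r and a 2-free column c: a second 2-free column makes
-- every 2-free row contain two positive vertices, and symmetrically for a second
-- 2-free row; otherwise r and c are the only 2-free lines, and the positive
-- neighbour of (r , c), lying in row r or in column c, makes that line heavy too.
-- Columns are handled as the rows of the transposed labelling.

open import Defs
open import Data.Nat using (ℕ; zero; suc; _+_; _*_; _≤_; z≤n; s≤s)
open import Data.Nat.Properties
  using (≤-refl; ≤-trans; ≤-reflexive; +-mono-≤; +-comm; *-comm; *-zeroʳ; *-monoʳ-≤;
         m≤m+n; m≤n+m; n≢0⇒n>0; +-0-commutativeMonoid)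
import Data.Nat as ℕ using (_≟_)
open import Data.Fin using (Fin; toℕ) renaming (zero to fzero; suc to fsuc)
open import Data.Fin.Patterns using (0F; 1F; 2F)
open import Data.Fin.Properties using (_≟_; any?; all?; ¬∀⟶∃¬)
open import Data.Product using (_×_; _,_; ∃; proj₂; swap)
open import Data.Sum using (_⊎_; inj₁; inj₂; [_,_])
open import Data.Empty using (⊥-elim)
open import Function using (_∘_)
open import Relation.Nullary using (¬_; yes; no)
open import Relation.Nullary.Decidable using (¬?; _×-dec_; decidable-stable)
open import Relation.Unary using (Pred; Decidable)
open import Relation.Binary.PropositionalEquality
  using (_≡_; _≢_; refl; sym; trans; cong; subst; module ≡-Reasoning)
open import Algebra.Properties.CommutativeMonoid.Sum +-0-commutativeMonoid
  using (sum; sum-cong-≗; ∑-comm)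

∑≡sum : ∀ k (g : Fin k → ℕ) → ∑ k g ≡ sum g
∑≡sum zero    g = refl
∑≡sum (suc k) g = cong (g fzero +_) (∑≡sum k (g ∘ fsuc))

∑-swap : ∀ {n m} (h : Fin n → Fin m → ℕ) →
         ∑ n (λ i → ∑ m (h i)) ≡ ∑ m (λ j → ∑ n (λ i → h i j))
∑-swap {n} {m} h = begin
  ∑ n (λ i → ∑ m (h i))          ≡⟨ ∑≡sum n _ ⟩
  sum (λ i → ∑ m (h i))          ≡⟨ sum-cong-≗ (λ i → ∑≡sum m (h i)) ⟩
  sum (λ i → sum (h i))          ≡⟨ ∑-comm h ⟩
  sum (λ j → sum (λ i → h i j))  ≡⟨ sum-cong-≗ (λ j → sym (∑≡sum n (λ i → h i j))) ⟩
  sum (λ j → ∑ n (λ i → h i j))  ≡⟨ sym (∑≡sum m _) ⟩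
  ∑ m (λ j → ∑ n (λ i → h i j))  ∎
  where open ≡-Reasoning

∑-const : ∀ k c → ∑ k (λ _ → c) ≡ k * c
∑-const zero    c = refl
∑-const (suc k) c = cong (c +_) (∑-const k c)

∑-mono-≤ : ∀ {k} {g h : Fin k → ℕ} → (∀ x → g x ≤ h x) → ∑ k g ≤ ∑ k h
∑-mono-≤ {zero}  g≤h = z≤n
∑-mono-≤ {suc k} g≤h = +-mono-≤ (g≤h fzero) (∑-mono-≤ (g≤h ∘ fsuc))

∑-lowerBound : ∀ {k c} (g : Fin k → ℕ) → (∀ x → c ≤ g x) → k * c ≤ ∑ k g
∑-lowerBound {k} {c} g c≤g = subst (_≤ ∑ k g) (∑-const k c) (∑-mono-≤ c≤g)

term≤∑ : ∀ {k} (g : Fin k → ℕ) x → g x ≤ ∑ k g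
term≤∑ g fzero    = m≤m+n _ _
term≤∑ g (fsuc x) = ≤-trans (term≤∑ (g ∘ fsuc) x) (m≤n+m _ _)

term+term≤∑ : ∀ {k} (g : Fin k → ℕ) {x y} → x ≢ y → g x + g y ≤ ∑ k g
term+term≤∑ g {fzero}  {fzero}  x≢y = ⊥-elim (x≢y refl)
term+term≤∑ g {fzero}  {fsuc y} x≢y = +-mono-≤ ≤-refl (term≤∑ (g ∘ fsuc) y)
term+term≤∑ g {fsuc x} {fzero}  x≢y =
  subst (_≤ ∑ _ g) (+-comm (g fzero) (g (fsuc x))) (+-mono-≤ ≤-refl (term≤∑ (g ∘ fsuc) x))
term+term≤∑ g {fsuc x} {fsuc y} x≢y =
  ≤-trans (term+term≤∑ (g ∘ fsuc) (x≢y ∘ cong fsuc)) (m≤n+m _ _)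

allBut : ∀ {k p} {P : Pred (Fin k) p} → Decidable P → ∀ {y} →
         ¬ ∃ (λ x → x ≢ y × ¬ P x) → ∀ x → x ≢ y → P x
allBut P? none x x≢y = decidable-stable (P? x) (λ ¬Px → none (x , x≢y , ¬Px))

private
  variable
    n m : ℕ

transpose : Labelling n m → Labelling m n
transpose f = f ∘ swap

weight-transpose : (f : Labelling n m) → weight (transpose f) ≡ weight f
weight-transpose f = sym (∑-swap (λ i j → toℕ (f (i , j))))

Adj-swap : {u v : Vertex n m} → Adj u v → Adj (swap u) (swap v)
Adj-swap (u≢v , inj₁ i≡s) = u≢v ∘ cong swap , inj₂ i≡s
Adj-swap (u≢v , inj₂ j≡t) = u≢v ∘ cong swap , inj₁ j≡t

IsTRDF-transpose : {f : Labelling n m} → IsTRDF f → IsTRDF (transpose f)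
IsTRDF-transpose T = record
  { dominating = λ v z → neighbour (dominating (swap v) z)
  ; total      = λ v z → neighbour (total (swap v) z)
  }
  where
  open IsTRDF T
  neighbour : ∀ {v} {P : Vertex n m → Set} →
              ∃ (λ u → Adj (swap v) u × P u) → ∃ (λ u → Adj v u × P (swap u))
  neighbour (u , adj , Pu) = swap u , Adj-swap adj , Pu

rowSum : Labelling n m → Fin n → ℕ
rowSum {m = m} f i = ∑ m (λ j → toℕ (f (i , j)))

HeavyRows : Labelling n m → Set
HeavyRows f = ∀ i → 2 ≤ rowSum f i

TwoInRow : Labelling n m → Fin n → Set
TwoInRow f i = ∃ λ j → toℕ (f (i , j)) ≡ 2

twoInRow? : (f : Labelling n m) → Decidable (TwoInRow f)
twoInRow? f i = any? (λ j → toℕ (f (i , j)) ℕ.≟ 2)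

HeavyRows⇒weight : (f : Labelling n m) → HeavyRows f → 2 * n ≤ weight f
HeavyRows⇒weight {n} f heavy = subst (_≤ weight f) (*-comm n 2) (∑-lowerBound (rowSum f) heavy)

twoInRow⇒heavy : (f : Labelling n m) {i : Fin n} → TwoInRow f i → 2 ≤ rowSum f i
twoInRow⇒heavy f (j , e) = ≤-trans (≤-reflexive (sym e)) (term≤∑ _ j)

nonzeroPair⇒heavy : (f : Labelling n m) {i : Fin n} {j j' : Fin m} → j ≢ j' →
                    toℕ (f (i , j)) ≢ 0 → toℕ (f (i , j')) ≢ 0 → 2 ≤ rowSum f i
nonzeroPair⇒heavy f j≢j' nz nz' =
  ≤-trans (+-mono-≤ (n≢0⇒n>0 nz) (n≢0⇒n>0 nz')) (term+term≤∑ _ j≢j')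

heavyRows-but-one : (f : Labelling n m) {r : Fin n} →
                    (∀ i → i ≢ r → TwoInRow f i) → 2 ≤ rowSum f r → HeavyRows f
heavyRows-but-one f {r} others heavy-r i with i ≟ r
... | yes refl = heavy-r
... | no  i≢r  = twoInRow⇒heavy f (others i i≢r)

nonzero-off-twos : {f : Labelling n m} → IsTRDF f → ∀ {i j} →
                   ¬ TwoInRow f i → ¬ TwoInRow (transpose f) j → toℕ (f (i , j)) ≢ 0
nonzero-off-twos T r2free c2free z with IsTRDF.dominating T _ z
... | (_ , t) , (_ , inj₁ refl) , e = r2free (t , e)
... | (s , _) , (_ , inj₂ refl) , e = c2free (s , e)

twoFreeCols⇒heavyRows : {f : Labelling n m} → IsTRDF f → ∀ {c c'} → c ≢ c' →
  ¬ TwoInRow (transpose f) c → ¬ TwoInRow (transpose f) c' → HeavyRows f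
twoFreeCols⇒heavyRows {f = f} T c≢c' c2free c'2free i with twoInRow? f i
... | yes two    = twoInRow⇒heavy f two
... | no  r2free = nonzeroPair⇒heavy f c≢c'
      (nonzero-off-twos T r2free c2free) (nonzero-off-twos T r2free c'2free)

uniqueTwoFreeCell : {f : Labelling n m} → IsTRDF f → ∀ {r c} →
  ¬ TwoInRow f r → ¬ TwoInRow (transpose f) c →
  (∀ i → i ≢ r → TwoInRow f i) → (∀ j → j ≢ c → TwoInRow (transpose f) j) →
  HeavyRows f ⊎ HeavyRows (transpose f)
uniqueTwoFreeCell {f = f} T {r} {c} r2free c2free otherRows otherCols
  with nonzero-off-twos T r2free c2free
... | nonzero-rc with IsTRDF.total T (r , c) nonzero-rc
... | (_ , t) , (rc≢rt , inj₁ refl) , nz = inj₁ (heavyRows-but-one f otherRows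
        (nonzeroPair⇒heavy f (rc≢rt ∘ cong (r ,_)) nonzero-rc nz))
... | (s , _) , (rc≢sc , inj₂ refl) , nz = inj₂ (heavyRows-but-one (transpose f) otherCols
        (nonzeroPair⇒heavy (transpose f) (rc≢sc ∘ cong (_, c)) nonzero-rc nz))

twoFreeCell : {f : Labelling n m} → IsTRDF f → ∀ {r c} →
  ¬ TwoInRow f r → ¬ TwoInRow (transpose f) c → HeavyRows f ⊎ HeavyRows (transpose f)
twoFreeCell {f = f} T {r} {c} r2free c2free
  with any? (λ j → ¬? (j ≟ c) ×-dec ¬? (twoInRow? (transpose f) j))
     | any? (λ i → ¬? (i ≟ r) ×-dec ¬? (twoInRow? f i))
... | yes (c' , c'≢c , c'2free) | _ = inj₁ (twoFreeCols⇒heavyRows T c'≢c c'2free c2free)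
... | no _ | yes (r' , r'≢r , r'2free) =
  inj₂ (twoFreeCols⇒heavyRows (IsTRDF-transpose T) r'≢r r'2free r2free)
... | no noOtherCol | no noOtherRow = uniqueTwoFreeCell T r2free c2free
  (allBut (twoInRow? f) noOtherRow) (allBut (twoInRow? (transpose f)) noOtherCol)

heavyRows⊎heavyCols : {f : Labelling n m} → IsTRDF f → HeavyRows f ⊎ HeavyRows (transpose f)
heavyRows⊎heavyCols {f = f} T with all? (twoInRow? f) | all? (twoInRow? (transpose f))
... | yes rows | _        = inj₁ (λ i → twoInRow⇒heavy f (rows i))
... | no _     | yes cols = inj₂ (λ j → twoInRow⇒heavy (transpose f) (cols j))
... | no ¬rows | no ¬cols = twoFreeCell T
  (proj₂ (¬∀⟶∃¬ _ _ (twoInRow? f) ¬rows)) (proj₂ (¬∀⟶∃¬ _ _ (twoInRow? (transpose f)) ¬cols))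

weight-lowerBound : n ≤ m → {f : Labelling n m} → IsTRDF f → 2 * n ≤ weight f
weight-lowerBound {n} {m} n≤m {f} T =
  [ HeavyRows⇒weight f , heavyCols⇒weight ] (heavyRows⊎heavyCols T)
  where
  heavyCols⇒weight : HeavyRows (transpose f) → 2 * n ≤ weight f
  heavyCols⇒weight heavy = ≤-trans (*-monoʳ-≤ 2 n≤m)
    (subst (2 * m ≤_) (weight-transpose f) (HeavyRows⇒weight (transpose f) heavy))

columnOfTwos : Labelling n (suc m)
columnOfTwos (_ , 0F)     = 2F
columnOfTwos (_ , fsuc _) = 0F

columnOfTwos-isTRDF : IsTRDF (columnOfTwos {suc (suc n)} {m})
columnOfTwos-isTRDF = record
  { dominating = λ where
      (i , fsuc _) _ → (i , 0F) , ((λ ()) , inj₁ refl) , refl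
  ; total = λ where
      (0F     , 0F)     _  → (1F , 0F) , ((λ ()) , inj₂ refl) , (λ ())
      (fsuc _ , 0F)     _  → (0F , 0F) , ((λ ()) , inj₂ refl) , (λ ())
      (_      , fsuc _) nz → ⊥-elim (nz refl)
  }

columnOfTwos-weight : weight (columnOfTwos {n} {m}) ≡ 2 * n
columnOfTwos-weight {n} {m} = begin
  ∑ n (λ _ → 2 + ∑ m (λ _ → 0))  ≡⟨ cong (λ z → ∑ n (λ _ → 2 + z)) (trans (∑-const m 0) (*-zeroʳ m)) ⟩
  ∑ n (λ _ → 2)                  ≡⟨ ∑-const n 2 ⟩
  n * 2                          ≡⟨ *-comm n 2 ⟩
  2 * n                          ∎
  where open ≡-Reasoning

mainTheorem16 : ∀ (n m : ℕ) → 2 ≤ n → n ≤ m → γtR≡ n m (2 * n)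
mainTheorem16 (suc (suc n)) (suc m) (s≤s (s≤s z≤n)) n≤m =
  (columnOfTwos , columnOfTwos-isTRDF , columnOfTwos-weight {suc (suc n)} {m}) ,
  λ f → weight-lowerBound n≤m
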